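{- Let $(G,D,u)$ be a left Hadamard group. Then (a) $(G,D,u)$ is a right Hadamard group; (b) $(G,D^{ -1},u)$ is a left Hadamard group, where $D^{ -1}=\{d^{ -1}:d\in D\}$; and (c) $(G^{\mathrm{op}},D,u)$ is a left Hadamard group.
   Context: A left Hadamard group of order $8n$ is a triple $(G,D,u)$ where $G$ is a group of order $8n$, $D\subseteq G$ has $4n$ elements, and $u$ is a central involution of $G$, such that (i) $|aD\cap D|=2n$ for every $a\in G\setminus\langle u\rangle$, and (ii) $|aD\cap\{b,bu\}|=1$ for all $a,b\in G$. A right Hadamard group is defined in the same way with left translates replaced by right translates: $|D\cap Da|=2n$ for $a\notin\langle u\rangle$ and $|Da\cap\{b,bu\}|=1$ for all $a,b$. $G^{\mathrm{op}}$ is the opposite group of $G$: same underlying set, with product $a\diamond b=b a$. -}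

module Defs where

open import Data.Nat using (ℕ; _*_)
open import Data.Bool using (Bool)
open import Data.Fin using (Fin)
open import Data.Fin.Properties using (_≟_; any?)
open import Data.Fin.Subset using (Subset; _∈_; _∩_; _∪_; ⁅_⁆; ∣_∣)
open import Data.Fin.Subset.Properties using (_∈?_)
open import Data.Vec using (tabulate)
open import Data.Product using (_×_; _,_)
open import Function using (flip)
open import Relation.Nullary using (¬_)
open import Relation.Nullary.Decidable using (⌊_⌋; _×-dec_)
open import Relation.Binary.PropositionalEquality
  using (_≡_; refl; sym; cong₂) renaming (isEquivalence to ≡-isEquivalence)
open import Algebra.Structures using (IsGroup; IsMonoid; IsSemigroup; IsMagma)

record FinGroup (m : ℕ) : Set where
  infixl 7 _∙_
  field
    _∙_     : Fin m → Fin m → Fin m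
    ε       : Fin m
    _⁻¹     : Fin m → Fin m
    isGroup : IsGroup _≡_ _∙_ ε _⁻¹
  open IsGroup isGroup public

op : ∀ {m} → FinGroup m → FinGroup m
op {m} G = record
  { _∙_ = flip _∙_
  ; ε = ε
  ; _⁻¹ = _⁻¹
  ; isGroup = record
    { isMonoid = record
      { isSemigroup = record
        { isMagma = record
          { isEquivalence = ≡-isEquivalence
          ; ∙-cong = λ p q → cong₂ _∙_ q p }
        ; assoc = λ x y z → sym (assoc z y x) }
      ; identity = identityʳ , identityˡ }
    ; inverse = inverseʳ , inverseˡ
    ; ⁻¹-cong = λ p → ⁻¹-cong p } }
  where open FinGroup G using (_∙_; ε; _⁻¹; assoc; identityˡ; identityʳ; inverseˡ; inverseʳ; ⁻¹-cong)

module _ {m : ℕ} (G : FinGroup m) where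
  open FinGroup G

  image : (Fin m → Fin m) → Subset m → Subset m
  image f D = tabulate λ g → ⌊ any? (λ d → (d ∈? D) ×-dec (f d ≟ g)) ⌋

  leftTr : Fin m → Subset m → Subset m
  leftTr a = image (a ∙_)

  rightTr : Subset m → Fin m → Subset m
  rightTr D a = image (_∙ a) D

  invSet : Subset m → Subset m
  invSet = image _⁻¹

  CentralInvolution : Fin m → Set
  CentralInvolution u = ¬ (u ≡ ε) × (u ∙ u ≡ ε) × (∀ g → u ∙ g ≡ g ∙ u)

  -- ⟨u⟩ = {ε, u} for an involution u
  notIn⟨_⟩ : Fin m → Fin m → Set
  notIn⟨ u ⟩ a = ¬ (a ≡ ε) × ¬ (a ≡ u)

IsLeftHadamard : (n : ℕ) (G : FinGroup (8 * n)) → Subset (8 * n) → Fin (8 * n) → Set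
IsLeftHadamard n G D u =
    CentralInvolution G u
  × ∣ D ∣ ≡ 4 * n
  × (∀ a → notIn⟨_⟩ G u a → ∣ leftTr G a D ∩ D ∣ ≡ 2 * n)
  × (∀ a b → ∣ leftTr G a D ∩ (⁅ b ⁆ ∪ ⁅ b ∙ u ⁆) ∣ ≡ 1)
  where open FinGroup G

IsRightHadamard : (n : ℕ) (G : FinGroup (8 * n)) → Subset (8 * n) → Fin (8 * n) → Set
IsRightHadamard n G D u =
    CentralInvolution G u
  × ∣ D ∣ ≡ 4 * n
  × (∀ a → notIn⟨_⟩ G u a → ∣ D ∩ rightTr G D a ∣ ≡ 2 * n)
  × (∀ a b → ∣ rightTr G D a ∩ (⁅ b ⁆ ∪ ⁅ b ∙ u ⁆) ∣ ≡ 1)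
  where open FinGroup G

module Submission where

-- Write χ for the indicator of D, L(b) = Σₓ χ(bx) χ(x) and R(c) = Σₓ χ(x) χ(xc), so that
-- |aD ∩ D| = L(a⁻¹), |D ∩ Da| = R(a⁻¹) and |aD⁻¹ ∩ D⁻¹| = R(a). The left Hadamard
-- condition says that L is constant off the central subgroup ⟨u⟩. On the other hand
-- L and R agree at central elements and have the same sum (|D|²) and the same sum of
-- squares, both counting solutions of x y⁻¹ = z w⁻¹ in D. For L constant off two
-- points this forces R = L by the equality case of Cauchy–Schwarz. All three claims
-- then follow by rewriting the intersection sizes through L and R.

open import Defs
open import Level using (0ℓ)
open import Algebra.Bundles using (Group)
import Algebra.Properties.Group as GroupProperties
open import Data.Bool using (true; false; if_then_else_; _∧_; _∨_)
open import Data.Fin using (Fin; zero; suc)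
open import Data.Fin.Properties using (_≟_; any?)
open import Data.Fin.Permutation using (permutation)
open import Data.Fin.Subset using (Subset; ⊥; _∈_; _∉_; _∩_; _∪_; ⁅_⁆; ∣_∣)
open import Data.Fin.Subset.Properties using (_∈?_; ∉⊥; x∈⁅x⁆; x∈⁅y⁆⇒x≡y; ∩-comm)
open import Data.Nat using (ℕ; zero; suc; _+_; _*_; ∣_-_∣)
open import Data.Nat.Properties hiding (_≟_)
open import Data.Nat.Solver using (module +-*-Solver)
open import Data.Product using (_×_; _,_; proj₁; proj₂)
open import Data.Sum using ([_,_]′)
open import Data.Vec using ([]; _∷_; lookup)
open import Data.Vec.Properties using (lookup-zipWith; lookup∘tabulate; []=⇒lookup; lookup⇒[]=)
open import Function using (_∘_; id)
open import Relation.Binary.PropositionalEquality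
open import Relation.Nullary using (yes; no; contradiction)
open import Relation.Nullary.Decidable using (⌊_⌋; _×-dec_)
open import Algebra.Properties.Semiring.Sum +-*-semiring
  using (sum; sum-syntax; sum-cong-≗; sum-replicate-zero; sum-permute; ∑-comm; ∑-distrib-+;
         *-distribˡ-sum; *-distribʳ-sum)
open +-*-Solver using (solve; _:+_; _:*_; _:=_; con)

∑-zero : ∀ {m} (f : Fin m → ℕ) → (∀ x → f x ≡ 0) → sum f ≡ 0
∑-zero {m} f f≡0 = trans (sum-cong-≗ f≡0) (sum-replicate-zero m)

∑≡0⇒≡0 : ∀ {m} (f : Fin m → ℕ) → sum f ≡ 0 → ∀ x → f x ≡ 0
∑≡0⇒≡0 f eq zero    = m+n≡0⇒m≡0 (f zero) eq
∑≡0⇒≡0 f eq (suc x) = ∑≡0⇒≡0 (f ∘ suc) (m+n≡0⇒n≡0 (f zero) eq) x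

∑-reindex : ∀ {m} {σ τ : Fin m → Fin m} → (∀ x → σ (τ x) ≡ x) → (∀ x → τ (σ x) ≡ x) →
            ∀ (φ : Fin m → ℕ) → ∑[ x < m ] φ (σ x) ≡ sum φ
∑-reindex στ τσ φ = sym (sum-permute φ (permutation _ _ στ τσ))

∑*∑≡∑∑ : ∀ {m} (f g : Fin m → ℕ) → sum f * sum g ≡ ∑[ x < m ] ∑[ y < m ] (f x * g y)
∑*∑≡∑∑ f g = trans (*-distribʳ-sum (sum g) f) (sum-cong-≗ λ x → *-distribˡ-sum (f x) g)

m*m+n*n≡2*m*n+∣m-n∣*∣m-n∣ : ∀ a b → a * a + b * b ≡ 2 * (a * b) + ∣ a - b ∣ * ∣ a - b ∣
m*m+n*n≡2*m*n+∣m-n∣*∣m-n∣ zero    b       = refl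
m*m+n*n≡2*m*n+∣m-n∣*∣m-n∣ (suc a) zero    =
  trans (+-identityʳ _) (cong (λ z → 2 * z + suc a * suc a) (sym (*-zeroʳ (suc a))))
m*m+n*n≡2*m*n+∣m-n∣*∣m-n∣ (suc a) (suc b) = begin
  suc a * suc a + suc b * suc b
    ≡⟨ solve 2 (λ a b → (con 1 :+ a) :* (con 1 :+ a) :+ (con 1 :+ b) :* (con 1 :+ b)
                        := (a :* a :+ b :* b) :+ con 2 :* (con 1 :+ a :+ b)) refl a b ⟩
  (a * a + b * b) + 2 * (1 + a + b)
    ≡⟨ cong (_+ 2 * (1 + a + b)) (m*m+n*n≡2*m*n+∣m-n∣*∣m-n∣ a b) ⟩
  (2 * (a * b) + d * d) + 2 * (1 + a + b)
    ≡⟨ solve 3 (λ a b d → (con 2 :* (a :* b) :+ d :* d) :+ con 2 :* (con 1 :+ a :+ b)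
                          := con 2 :* ((con 1 :+ a) :* (con 1 :+ b)) :+ d :* d) refl a b d ⟩
  2 * (suc a * suc b) + d * d ∎
  where
  open ≡-Reasoning
  d : ℕ
  d = ∣ a - b ∣

∑-distrib-+₃ : ∀ {m} (f g k : Fin m → ℕ) →
  ∑[ x < m ] (f x + (g x + k x)) ≡ sum f + (sum g + sum k)
∑-distrib-+₃ f g k = trans (∑-distrib-+ f (λ x → g x + k x)) (cong (sum f +_) (∑-distrib-+ g k))

-- The equality case of Cauchy–Schwarz: Σ (f − g)² = Σ f² − 2 Σ f g + Σ g² vanishes.
≗-if-∑-cross≡∑-squares : ∀ {m} (f g : Fin m → ℕ) →
  ∑[ x < m ] (f x * g x) ≡ ∑[ x < m ] (g x * g x) →
  ∑[ x < m ] (f x * f x) ≡ ∑[ x < m ] (g x * g x) →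
  ∀ x → f x ≡ g x
≗-if-∑-cross≡∑-squares {m} f g ∑fg≡∑gg ∑ff≡∑gg x =
  ∣m-n∣≡0⇒m≡n ([ id , id ]′ (m*n≡0⇒m≡0∨n≡0 (d x) (∑≡0⇒≡0 (λ y → d y * d y) ∑dd≡0 x)))
  where
  open ≡-Reasoning
  d : Fin m → ℕ
  d y = ∣ f y - g y ∣
  S : ℕ
  S = ∑[ y < m ] (f y * g y)
  expansion : 2 * S + ∑[ y < m ] (d y * d y) ≡ 2 * S + 0
  expansion = begin
    2 * S + ∑[ y < m ] (d y * d y)
      ≡⟨ cong (_+ ∑[ y < m ] (d y * d y)) (*-distribˡ-sum 2 (λ y → f y * g y)) ⟩
    ∑[ y < m ] (2 * (f y * g y)) + ∑[ y < m ] (d y * d y)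
      ≡⟨ ∑-distrib-+ (λ y → 2 * (f y * g y)) (λ y → d y * d y) ⟨
    ∑[ y < m ] (2 * (f y * g y) + d y * d y)
      ≡⟨ sum-cong-≗ (λ y → m*m+n*n≡2*m*n+∣m-n∣*∣m-n∣ (f y) (g y)) ⟨
    ∑[ y < m ] (f y * f y + g y * g y)
      ≡⟨ ∑-distrib-+ (λ y → f y * f y) (λ y → g y * g y) ⟩
    ∑[ y < m ] (f y * f y) + ∑[ y < m ] (g y * g y)
      ≡⟨ cong₂ _+_ (trans ∑ff≡∑gg (sym ∑fg≡∑gg)) (sym ∑fg≡∑gg) ⟩
    S + S
      ≡⟨ cong (S +_) (+-identityʳ S) ⟨
    2 * S
      ≡⟨ +-identityʳ (2 * S) ⟨
    2 * S + 0 ∎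
  ∑dd≡0 : ∑[ y < m ] (d y * d y) ≡ 0
  ∑dd≡0 = +-cancelˡ-≡ (2 * S) _ _ expansion

𝟙 : ∀ {m} → Subset m → Fin m → ℕ
𝟙 S x = if lookup S x then 1 else 0

𝟙-∈ : ∀ {m} {S : Subset m} {x} → x ∈ S → 𝟙 S x ≡ 1
𝟙-∈ x∈S rewrite []=⇒lookup x∈S = refl

𝟙-∉ : ∀ {m} {S : Subset m} {x} → x ∉ S → 𝟙 S x ≡ 0
𝟙-∉ {S = S} {x} x∉S with lookup S x in eq
... | true  = contradiction (lookup⇒[]= x S eq) x∉S
... | false = refl

𝟙-⁅x⁆-x : ∀ {m} (x : Fin m) → 𝟙 ⁅ x ⁆ x ≡ 1
𝟙-⁅x⁆-x x = 𝟙-∈ (x∈⁅x⁆ x)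

𝟙-⁅y⁆-x : ∀ {m} {x y : Fin m} → x ≢ y → 𝟙 ⁅ y ⁆ x ≡ 0
𝟙-⁅y⁆-x {y = y} x≢y = 𝟙-∉ (x≢y ∘ x∈⁅y⁆⇒x≡y y)

𝟙-∩ : ∀ {m} (S T : Subset m) x → 𝟙 (S ∩ T) x ≡ 𝟙 S x * 𝟙 T x
𝟙-∩ S T x rewrite lookup-zipWith _∧_ x S T with lookup S x | lookup T x
... | true  | true  = refl
... | true  | false = refl
... | false | _     = refl

𝟙-⁅⁆∪⁅⁆ : ∀ {m} {b c : Fin m} → b ≢ c → ∀ x → 𝟙 (⁅ b ⁆ ∪ ⁅ c ⁆) x ≡ 𝟙 ⁅ b ⁆ x + 𝟙 ⁅ c ⁆ x
𝟙-⁅⁆∪⁅⁆ {b = b} {c} b≢c x rewrite lookup-zipWith _∨_ x ⁅ b ⁆ ⁅ c ⁆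
  with lookup ⁅ b ⁆ x in x∈b | lookup ⁅ c ⁆ x in x∈c
... | true  | true  = contradiction (trans (sym (x∈⁅y⁆⇒x≡y b (lookup⇒[]= x _ x∈b)))
                                          (x∈⁅y⁆⇒x≡y c (lookup⇒[]= x _ x∈c))) b≢c
... | true  | false = refl
... | false | true  = refl
... | false | false = refl

∣∣≡∑𝟙 : ∀ {m} (S : Subset m) → ∣ S ∣ ≡ sum (𝟙 S)
∣∣≡∑𝟙 []          = refl
∣∣≡∑𝟙 (true ∷ S)  = cong suc (∣∣≡∑𝟙 S)
∣∣≡∑𝟙 (false ∷ S) = ∣∣≡∑𝟙 S

∣∩∣≡∑𝟙*𝟙 : ∀ {m} (S T : Subset m) → ∣ S ∩ T ∣ ≡ ∑[ x < m ] (𝟙 S x * 𝟙 T x)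
∣∩∣≡∑𝟙*𝟙 S T = trans (∣∣≡∑𝟙 (S ∩ T)) (sum-cong-≗ (𝟙-∩ S T))

∑-*𝟙⁅⁆ : ∀ {m} (f : Fin m → ℕ) b → ∑[ x < m ] (f x * 𝟙 ⁅ b ⁆ x) ≡ f b
∑-*𝟙⁅⁆ {suc m} f zero =
  trans (cong₂ _+_ (*-identityʳ (f zero)) (∑-zero _ tail≡0)) (+-identityʳ (f zero))
  where
  tail≡0 : ∀ x → f (suc x) * 𝟙 ⁅ zero ⁆ (suc x) ≡ 0
  tail≡0 x = trans (cong (f (suc x) *_) (𝟙-∉ {S = ⊥ {n = m}} {x} ∉⊥)) (*-zeroʳ (f (suc x)))
∑-*𝟙⁅⁆ {suc m} f (suc b) =
  trans (cong (_+ ∑[ x < m ] (f (suc x) * 𝟙 ⁅ b ⁆ x)) (*-zeroʳ (f zero))) (∑-*𝟙⁅⁆ (f ∘ suc) b)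

∣∩⁅⁆∪⁅⁆∣ : ∀ {m} (S : Subset m) {b c} → b ≢ c → ∣ S ∩ (⁅ b ⁆ ∪ ⁅ c ⁆) ∣ ≡ 𝟙 S b + 𝟙 S c
∣∩⁅⁆∪⁅⁆∣ {m} S {b} {c} b≢c = begin
  ∣ S ∩ (⁅ b ⁆ ∪ ⁅ c ⁆) ∣
    ≡⟨ ∣∩∣≡∑𝟙*𝟙 S _ ⟩
  ∑[ x < m ] (𝟙 S x * 𝟙 (⁅ b ⁆ ∪ ⁅ c ⁆) x)
    ≡⟨ sum-cong-≗ (λ x → trans (cong (𝟙 S x *_) (𝟙-⁅⁆∪⁅⁆ b≢c x)) (*-distribˡ-+ (𝟙 S x) _ _)) ⟩
  ∑[ x < m ] (𝟙 S x * 𝟙 ⁅ b ⁆ x + 𝟙 S x * 𝟙 ⁅ c ⁆ x)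
    ≡⟨ ∑-distrib-+ (λ x → 𝟙 S x * 𝟙 ⁅ b ⁆ x) (λ x → 𝟙 S x * 𝟙 ⁅ c ⁆ x) ⟩
  ∑[ x < m ] (𝟙 S x * 𝟙 ⁅ b ⁆ x) + ∑[ x < m ] (𝟙 S x * 𝟙 ⁅ c ⁆ x)
    ≡⟨ cong₂ _+_ (∑-*𝟙⁅⁆ (𝟙 S) b) (∑-*𝟙⁅⁆ (𝟙 S) c) ⟩
  𝟙 S b + 𝟙 S c ∎
  where open ≡-Reasoning

-- For g constant off {p, q}, Σ φ g is determined by Σ φ, φ p and φ q; hence
-- Σ f g = Σ g g, and Cauchy–Schwarz applies.
module _ {m : ℕ} {p q : Fin m} (p≢q : p ≢ q) {g : Fin m → ℕ} {h : ℕ}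
         (g-off : ∀ a → a ≢ p → a ≢ q → g a ≡ h) where

  private
    δ : Fin m → Fin m → ℕ
    δ b = 𝟙 ⁅ b ⁆

  *-split-off-two-points : ∀ (φ : Fin m → ℕ) a →
    φ a * g a + (φ a * h * δ p a + φ a * h * δ q a) ≡
    φ a * h + (φ a * g p * δ p a + φ a * g q * δ q a)
  *-split-off-two-points φ a with a ≟ p | a ≟ q
  ... | yes refl | _
    rewrite 𝟙-⁅x⁆-x a | 𝟙-⁅y⁆-x p≢q =
      solve 4 (λ φ g h g′ → φ :* g :+ (φ :* h :* con 1 :+ φ :* h :* con 0)
                          := φ :* h :+ (φ :* g :* con 1 :+ φ :* g′ :* con 0))
        refl (φ a) (g a) h (g q)
  ... | no a≢p | yes refl
    rewrite 𝟙-⁅x⁆-x a | 𝟙-⁅y⁆-x a≢p =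
      solve 4 (λ φ g h g′ → φ :* g :+ (φ :* h :* con 0 :+ φ :* h :* con 1)
                          := φ :* h :+ (φ :* g′ :* con 0 :+ φ :* g :* con 1))
        refl (φ a) (g a) h (g p)
  ... | no a≢p | no a≢q
    rewrite g-off a a≢p a≢q | 𝟙-⁅y⁆-x a≢p | 𝟙-⁅y⁆-x a≢q =
      solve 4 (λ φ h g g′ → φ :* h :+ (φ :* h :* con 0 :+ φ :* h :* con 0)
                          := φ :* h :+ (φ :* g :* con 0 :+ φ :* g′ :* con 0))
        refl (φ a) h (g p) (g q)

  ∑-*-split-off-two-points : ∀ (φ : Fin m → ℕ) →
    ∑[ a < m ] (φ a * g a) + (φ p * h + φ q * h) ≡
    ∑[ a < m ] (φ a * h) + (φ p * g p + φ q * g q)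
  ∑-*-split-off-two-points φ = begin
    ∑[ a < m ] (φ a * g a) + (φ p * h + φ q * h)
      ≡⟨ cong (∑[ a < m ] (φ a * g a) +_)
              (cong₂ _+_ (∑-*𝟙⁅⁆ (λ a → φ a * h) p) (∑-*𝟙⁅⁆ (λ a → φ a * h) q)) ⟨
    ∑[ a < m ] (φ a * g a) + (∑[ a < m ] (φ a * h * δ p a) + ∑[ a < m ] (φ a * h * δ q a))
      ≡⟨ ∑-distrib-+₃ (λ a → φ a * g a) (λ a → φ a * h * δ p a) (λ a → φ a * h * δ q a) ⟨
    ∑[ a < m ] (φ a * g a + (φ a * h * δ p a + φ a * h * δ q a))
      ≡⟨ sum-cong-≗ (*-split-off-two-points φ) ⟩
    ∑[ a < m ] (φ a * h + (φ a * g p * δ p a + φ a * g q * δ q a))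
      ≡⟨ ∑-distrib-+₃ (λ a → φ a * h) (λ a → φ a * g p * δ p a) (λ a → φ a * g q * δ q a) ⟩
    ∑[ a < m ] (φ a * h) + (∑[ a < m ] (φ a * g p * δ p a) + ∑[ a < m ] (φ a * g q * δ q a))
      ≡⟨ cong (∑[ a < m ] (φ a * h) +_)
              (cong₂ _+_ (∑-*𝟙⁅⁆ (λ a → φ a * g p) p) (∑-*𝟙⁅⁆ (λ a → φ a * g q) q)) ⟩
    ∑[ a < m ] (φ a * h) + (φ p * g p + φ q * g q) ∎
    where open ≡-Reasoning

  ≗-if-moments-agree : ∀ {f : Fin m → ℕ} → f p ≡ g p → f q ≡ g q → sum f ≡ sum g →
    ∑[ a < m ] (f a * f a) ≡ ∑[ a < m ] (g a * g a) → ∀ a → f a ≡ g a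
  ≗-if-moments-agree {f} fp≡gp fq≡gq ∑f≡∑g = ≗-if-∑-cross≡∑-squares f g ∑fg≡∑gg
    where
    open ≡-Reasoning
    ∑fh≡∑gh : ∑[ a < m ] (f a * h) ≡ ∑[ a < m ] (g a * h)
    ∑fh≡∑gh = begin
      ∑[ a < m ] (f a * h) ≡⟨ *-distribʳ-sum h f ⟨
      sum f * h            ≡⟨ cong (_* h) ∑f≡∑g ⟩
      sum g * h            ≡⟨ *-distribʳ-sum h g ⟩
      ∑[ a < m ] (g a * h) ∎
    ∑fg≡∑gg : ∑[ a < m ] (f a * g a) ≡ ∑[ a < m ] (g a * g a)
    ∑fg≡∑gg = +-cancelʳ-≡ (f p * h + f q * h) _ _ (begin
      ∑[ a < m ] (f a * g a) + (f p * h + f q * h)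
        ≡⟨ ∑-*-split-off-two-points f ⟩
      ∑[ a < m ] (f a * h) + (f p * g p + f q * g q)
        ≡⟨ cong₂ _+_ ∑fh≡∑gh (cong₂ _+_ (cong (_* g p) fp≡gp) (cong (_* g q) fq≡gq)) ⟩
      ∑[ a < m ] (g a * h) + (g p * g p + g q * g q)
        ≡⟨ ∑-*-split-off-two-points g ⟨
      ∑[ a < m ] (g a * g a) + (g p * h + g q * h)
        ≡⟨ cong (∑[ a < m ] (g a * g a) +_)
                (cong₂ _+_ (cong (_* h) fp≡gp) (cong (_* h) fq≡gq)) ⟨
      ∑[ a < m ] (g a * g a) + (f p * h + f q * h) ∎)

-- Left and right autocorrelations on a finite group

toGroup : ∀ {m} → FinGroup m → Group 0ℓ 0ℓ
toGroup G = record { isGroup = FinGroup.isGroup G }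

module _ {m : ℕ} (G : FinGroup m) where
  open FinGroup G using (_∙_; ε; _⁻¹; assoc; identityˡ; identityʳ)
  open GroupProperties (toGroup G)
    using (\\-leftDividesˡ; \\-leftDividesʳ; //-rightDividesˡ; //-rightDividesʳ;
           ⁻¹-involutive; ⁻¹-anti-homo-∙)

  leftCorr : (Fin m → ℕ) → Fin m → ℕ
  leftCorr φ b = ∑[ x < m ] (φ (b ∙ x) * φ x)

  rightCorr : (Fin m → ℕ) → Fin m → ℕ
  rightCorr φ c = ∑[ x < m ] (φ x * φ (x ∙ c))

  ∑-∙ˡ : ∀ a (φ : Fin m → ℕ) → ∑[ x < m ] φ (a ∙ x) ≡ sum φ
  ∑-∙ˡ a = ∑-reindex (\\-leftDividesˡ a) (\\-leftDividesʳ a)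

  ∑-∙ʳ : ∀ a (φ : Fin m → ℕ) → ∑[ x < m ] φ (x ∙ a) ≡ sum φ
  ∑-∙ʳ a = ∑-reindex (//-rightDividesˡ a) (//-rightDividesʳ a)

  ∑-⁻¹ : ∀ (φ : Fin m → ℕ) → ∑[ x < m ] φ (x ⁻¹) ≡ sum φ
  ∑-⁻¹ = ∑-reindex ⁻¹-involutive ⁻¹-involutive

  ∑-leftCorr : ∀ φ → sum (leftCorr φ) ≡ sum φ * sum φ
  ∑-leftCorr φ = begin
    ∑[ b < m ] ∑[ x < m ] (φ (b ∙ x) * φ x)   ≡⟨ ∑-comm (λ b x → φ (b ∙ x) * φ x) ⟩
    ∑[ x < m ] ∑[ b < m ] (φ (b ∙ x) * φ x)   ≡⟨ sum-cong-≗ (λ x → *-distribʳ-sum (φ x) (λ b → φ (b ∙ x))) ⟨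
    ∑[ x < m ] (∑[ b < m ] φ (b ∙ x) * φ x)   ≡⟨ sum-cong-≗ (λ x → cong (_* φ x) (∑-∙ʳ x φ)) ⟩
    ∑[ x < m ] (sum φ * φ x)                  ≡⟨ *-distribˡ-sum (sum φ) φ ⟨
    sum φ * sum φ                             ∎
    where open ≡-Reasoning

  ∑-rightCorr : ∀ φ → sum (rightCorr φ) ≡ sum φ * sum φ
  ∑-rightCorr φ = begin
    ∑[ c < m ] ∑[ x < m ] (φ x * φ (x ∙ c))   ≡⟨ ∑-comm (λ c x → φ x * φ (x ∙ c)) ⟩
    ∑[ x < m ] ∑[ c < m ] (φ x * φ (x ∙ c))   ≡⟨ sum-cong-≗ (λ x → *-distribˡ-sum (φ x) (λ c → φ (x ∙ c))) ⟨
    ∑[ x < m ] (φ x * ∑[ c < m ] φ (x ∙ c))   ≡⟨ sum-cong-≗ (λ x → cong (φ x *_) (∑-∙ˡ x φ)) ⟩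
    ∑[ x < m ] (φ x * sum φ)                  ≡⟨ *-distribʳ-sum (sum φ) φ ⟨
    sum φ * sum φ                             ∎
    where open ≡-Reasoning

  leftCorr≡rightCorr-central : ∀ φ {z} → (∀ g → z ∙ g ≡ g ∙ z) → leftCorr φ z ≡ rightCorr φ z
  leftCorr≡rightCorr-central φ z-central =
    sum-cong-≗ λ x → trans (cong (λ y → φ y * φ x) (z-central x)) (*-comm (φ (x ∙ _)) (φ x))

  -- Both sides count quadruples (x, y, z, w) weighted by φ x φ y φ z φ w: the left
  -- those with x y⁻¹ = z w⁻¹, the right those with x⁻¹ y = z⁻¹ w; and
  -- x y⁻¹ = z w⁻¹ iff z⁻¹ x = w⁻¹ y.
  ∑-leftCorr²≡∑-rightCorr² : ∀ φ →
    ∑[ b < m ] (leftCorr φ b * leftCorr φ b) ≡ ∑[ c < m ] (rightCorr φ c * rightCorr φ c)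
  ∑-leftCorr²≡∑-rightCorr² φ = begin
    ∑[ b < m ] (leftCorr φ b * leftCorr φ b)
      ≡⟨ sum-cong-≗ (λ b → ∑*∑≡∑∑ (l b) (l b)) ⟩
    ∑[ b < m ] ∑[ x < m ] ∑[ y < m ] L b x y
      ≡⟨ sum-cong-≗ (λ b → ∑-comm (L b)) ⟩
    ∑[ b < m ] ∑[ y < m ] ∑[ x < m ] L b x y
      ≡⟨ ∑-comm (λ b y → ∑[ x < m ] L b x y) ⟩
    ∑[ y < m ] ∑[ b < m ] ∑[ x < m ] L b x y
      ≡⟨ sum-cong-≗ (λ y → ∑-∙ʳ (y ⁻¹) (λ b → ∑[ x < m ] L b x y)) ⟨
    ∑[ y < m ] ∑[ z < m ] ∑[ x < m ] L (z ∙ y ⁻¹) x y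
      ≡⟨ sum-cong-≗ (λ y → sum-cong-≗ λ z → sum-cong-≗ λ x → L≡Q y z x) ⟩
    ∑[ y < m ] ∑[ z < m ] ∑[ x < m ] Q y z x
      ≡⟨ sum-cong-≗ (λ y → sum-cong-≗ λ z → sum-cong-≗ λ x → R≡Q y z x) ⟨
    ∑[ y < m ] ∑[ x < m ] ∑[ z < m ] R (y ⁻¹ ∙ z) x y
      ≡⟨ sum-cong-≗ (λ y → sum-cong-≗ λ x → ∑-∙ˡ (y ⁻¹) (λ c → R c x y)) ⟩
    ∑[ y < m ] ∑[ x < m ] ∑[ c < m ] R c x y
      ≡⟨ sum-cong-≗ (λ y → ∑-comm (λ x c → R c x y)) ⟩
    ∑[ y < m ] ∑[ c < m ] ∑[ x < m ] R c x y
      ≡⟨ ∑-comm (λ c y → ∑[ x < m ] R c x y) ⟨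
    ∑[ c < m ] ∑[ y < m ] ∑[ x < m ] R c x y
      ≡⟨ sum-cong-≗ (λ c → ∑-comm (R c)) ⟨
    ∑[ c < m ] ∑[ x < m ] ∑[ y < m ] R c x y
      ≡⟨ sum-cong-≗ (λ c → ∑*∑≡∑∑ (r c) (r c)) ⟨
    ∑[ c < m ] (rightCorr φ c * rightCorr φ c) ∎
    where
    open ≡-Reasoning
    l r : Fin m → Fin m → ℕ
    l b x = φ (b ∙ x) * φ x
    r c x = φ x * φ (x ∙ c)
    L R : Fin m → Fin m → Fin m → ℕ
    L b x y = l b x * l b y
    R c x y = r c x * r c y
    Q : Fin m → Fin m → Fin m → ℕ
    Q y z x = (φ z * φ (z ∙ (y ⁻¹ ∙ x))) * (φ y * φ x)
    L≡Q : ∀ y z x → L (z ∙ y ⁻¹) x y ≡ Q y z x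
    L≡Q y z x = begin
      (φ (z ∙ y ⁻¹ ∙ x) * φ x) * (φ (z ∙ y ⁻¹ ∙ y) * φ y)
        ≡⟨ cong₂ (λ s t → (φ s * φ x) * (φ t * φ y)) (assoc z (y ⁻¹) x) (//-rightDividesˡ y z) ⟩
      (φ (z ∙ (y ⁻¹ ∙ x)) * φ x) * (φ z * φ y)
        ≡⟨ solve 4 (λ s x z y → (s :* x) :* (z :* y) := (z :* s) :* (y :* x))
                   refl (φ (z ∙ (y ⁻¹ ∙ x))) (φ x) (φ z) (φ y) ⟩
      (φ z * φ (z ∙ (y ⁻¹ ∙ x))) * (φ y * φ x) ∎
    R≡Q : ∀ y z x → R (y ⁻¹ ∙ x) z y ≡ Q y z x
    R≡Q y z x = cong (λ t → (φ z * φ (z ∙ (y ⁻¹ ∙ x))) * (φ y * φ t)) (\\-leftDividesˡ y x)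

  rightCorr≗leftCorr : ∀ {φ u h} → u ≢ ε → (∀ g → u ∙ g ≡ g ∙ u) →
    (∀ a → a ≢ ε → a ≢ u → leftCorr φ a ≡ h) → ∀ c → rightCorr φ c ≡ leftCorr φ c
  rightCorr≗leftCorr {φ} u≢ε u-central leftCorr-off =
    ≗-if-moments-agree (u≢ε ∘ sym) leftCorr-off
      (sym (leftCorr≡rightCorr-central φ ε-central))
      (sym (leftCorr≡rightCorr-central φ u-central))
      (trans (∑-rightCorr φ) (sym (∑-leftCorr φ)))
      (sym (∑-leftCorr²≡∑-rightCorr² φ))
    where
    ε-central : ∀ g → ε ∙ g ≡ g ∙ ε
    ε-central g = trans (identityˡ g) (sym (identityʳ g))

  𝟙-image : ∀ {σ τ : Fin m → Fin m} → (∀ x → σ (τ x) ≡ x) → (∀ x → τ (σ x) ≡ x) →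
            ∀ S x → 𝟙 (image G σ S) x ≡ 𝟙 S (τ x)
  𝟙-image {σ} {τ} στ τσ S x
    rewrite lookup∘tabulate (λ g → ⌊ any? (λ d → (d ∈? S) ×-dec (σ d ≟ g)) ⌋) x
    with any? (λ d → (d ∈? S) ×-dec (σ d ≟ x))
  ... | yes (d , d∈S , refl) rewrite τσ d | []=⇒lookup d∈S = refl
  ... | no ∄d with lookup S (τ x) in τx∈S
  ...   | true  = contradiction (τ x , lookup⇒[]= (τ x) S τx∈S , στ x) ∄d
  ...   | false = refl

  𝟙-leftTr : ∀ a S x → 𝟙 (leftTr G a S) x ≡ 𝟙 S (a ⁻¹ ∙ x)
  𝟙-leftTr a = 𝟙-image (\\-leftDividesˡ a) (\\-leftDividesʳ a)

  𝟙-rightTr : ∀ a S x → 𝟙 (rightTr G S a) x ≡ 𝟙 S (x ∙ a ⁻¹)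
  𝟙-rightTr a = 𝟙-image (//-rightDividesˡ a) (//-rightDividesʳ a)

  𝟙-invSet : ∀ S x → 𝟙 (invSet G S) x ≡ 𝟙 S (x ⁻¹)
  𝟙-invSet = 𝟙-image ⁻¹-involutive ⁻¹-involutive

  ∣leftTr∩∣≡leftCorr : ∀ a S → ∣ leftTr G a S ∩ S ∣ ≡ leftCorr (𝟙 S) (a ⁻¹)
  ∣leftTr∩∣≡leftCorr a S =
    trans (∣∩∣≡∑𝟙*𝟙 (leftTr G a S) S) (sum-cong-≗ λ x → cong (_* 𝟙 S x) (𝟙-leftTr a S x))

  ∣∩rightTr∣≡rightCorr : ∀ a S → ∣ S ∩ rightTr G S a ∣ ≡ rightCorr (𝟙 S) (a ⁻¹)
  ∣∩rightTr∣≡rightCorr a S =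
    trans (∣∩∣≡∑𝟙*𝟙 S (rightTr G S a)) (sum-cong-≗ λ x → cong (𝟙 S x *_) (𝟙-rightTr a S x))

  ∣leftTr-invSet∩invSet∣≡rightCorr : ∀ a S →
    ∣ leftTr G a (invSet G S) ∩ invSet G S ∣ ≡ rightCorr (𝟙 S) a
  ∣leftTr-invSet∩invSet∣≡rightCorr a S = begin
    ∣ leftTr G a (invSet G S) ∩ invSet G S ∣
      ≡⟨ ∣∩∣≡∑𝟙*𝟙 (leftTr G a (invSet G S)) (invSet G S) ⟩
    ∑[ x < m ] (𝟙 (leftTr G a (invSet G S)) x * 𝟙 (invSet G S) x)
      ≡⟨ sum-cong-≗ (λ x → cong₂ _*_ (trans (𝟙-leftTr a _ x) (𝟙-invSet S _)) (𝟙-invSet S x)) ⟩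
    ∑[ x < m ] (χ ((a ⁻¹ ∙ x) ⁻¹) * χ (x ⁻¹))
      ≡⟨ ∑-⁻¹ (λ x → χ ((a ⁻¹ ∙ x) ⁻¹) * χ (x ⁻¹)) ⟨
    ∑[ x < m ] (χ ((a ⁻¹ ∙ x ⁻¹) ⁻¹) * χ (x ⁻¹ ⁻¹))
      ≡⟨ sum-cong-≗ (λ x → trans (cong₂ (λ s t → χ s * χ t) ([a⁻¹x⁻¹]⁻¹≡xa x) (⁻¹-involutive x))
                                 (*-comm (χ (x ∙ a)) (χ x))) ⟩
    rightCorr χ a ∎
    where
    open ≡-Reasoning
    χ : Fin m → ℕ
    χ = 𝟙 S
    [a⁻¹x⁻¹]⁻¹≡xa : ∀ x → (a ⁻¹ ∙ x ⁻¹) ⁻¹ ≡ x ∙ a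
    [a⁻¹x⁻¹]⁻¹≡xa x = trans (⁻¹-anti-homo-∙ (a ⁻¹) (x ⁻¹))
                          (cong₂ _∙_ (⁻¹-involutive x) (⁻¹-involutive a))

module LeftHadamard (n : ℕ) (G : FinGroup (8 * n)) (D : Subset (8 * n)) (u : Fin (8 * n))
                    (H : IsLeftHadamard n G D u) where
  open FinGroup G using (_∙_; ε; _⁻¹; assoc; identityˡ; inverseˡ)
  open GroupProperties (toGroup G)
    using (\\-leftDividesʳ; ⁻¹-involutive; ⁻¹-injective; ⁻¹-anti-homo-∙; ε⁻¹≈ε; inverseˡ-unique)

  private
    χ : Fin (8 * n) → ℕ
    χ = 𝟙 D

  u≢ε : u ≢ ε
  u≢ε = proj₁ (proj₁ H)

  u∙u≡ε : u ∙ u ≡ ε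
  u∙u≡ε = proj₁ (proj₂ (proj₁ H))

  u-central : ∀ g → u ∙ g ≡ g ∙ u
  u-central = proj₂ (proj₂ (proj₁ H))

  ∣D∣≡4n : ∣ D ∣ ≡ 4 * n
  ∣D∣≡4n = proj₁ (proj₂ H)

  ∣aD∩D∣≡2n : ∀ a → notIn⟨_⟩ G u a → ∣ leftTr G a D ∩ D ∣ ≡ 2 * n
  ∣aD∩D∣≡2n = proj₁ (proj₂ (proj₂ H))

  ∣aD∩⁅b⁆∪⁅bu⁆∣≡1 : ∀ a b → ∣ leftTr G a D ∩ (⁅ b ⁆ ∪ ⁅ b ∙ u ⁆) ∣ ≡ 1
  ∣aD∩⁅b⁆∪⁅bu⁆∣≡1 = proj₂ (proj₂ (proj₂ H))

  u⁻¹≡u : u ⁻¹ ≡ u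
  u⁻¹≡u = sym (inverseˡ-unique u u u∙u≡ε)

  b≢bu : ∀ b → b ≢ b ∙ u
  b≢bu b b≡bu = u≢ε (begin
    u              ≡⟨ \\-leftDividesʳ b u ⟨
    b ⁻¹ ∙ (b ∙ u) ≡⟨ cong (b ⁻¹ ∙_) b≡bu ⟨
    b ⁻¹ ∙ b       ≡⟨ inverseˡ b ⟩
    ε              ∎)
    where open ≡-Reasoning

  notIn⟨u⟩-⁻¹ : ∀ a → notIn⟨_⟩ G u a → notIn⟨_⟩ G u (a ⁻¹)
  notIn⟨u⟩-⁻¹ a (a≢ε , a≢u) =
    (λ a⁻¹≡ε → a≢ε (⁻¹-injective (trans a⁻¹≡ε (sym ε⁻¹≈ε)))) ,
    (λ a⁻¹≡u → a≢u (⁻¹-injective (trans a⁻¹≡u (sym u⁻¹≡u))))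

  ∙u∙≡∙∙u : ∀ x y → x ∙ u ∙ y ≡ x ∙ y ∙ u
  ∙u∙≡∙∙u x y = trans (assoc x u y) (trans (cong (x ∙_) (u-central y)) (sym (assoc x y u)))

  χ-b+χ-bu≡1 : ∀ b → χ b + χ (b ∙ u) ≡ 1
  χ-b+χ-bu≡1 b = begin
    χ b + χ (b ∙ u)
      ≡⟨ cong₂ _+_ (εD b) (εD (b ∙ u)) ⟨
    𝟙 (leftTr G ε D) b + 𝟙 (leftTr G ε D) (b ∙ u)
      ≡⟨ ∣∩⁅⁆∪⁅⁆∣ (leftTr G ε D) (b≢bu b) ⟨
    ∣ leftTr G ε D ∩ (⁅ b ⁆ ∪ ⁅ b ∙ u ⁆) ∣
      ≡⟨ ∣aD∩⁅b⁆∪⁅bu⁆∣≡1 ε b ⟩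
    1 ∎
    where
    open ≡-Reasoning
    εD : ∀ x → 𝟙 (leftTr G ε D) x ≡ χ x
    εD x = trans (𝟙-leftTr G ε D x) (cong χ (trans (cong (_∙ x) ε⁻¹≈ε) (identityˡ x)))

  meets-coset-once : ∀ T b y → 𝟙 T b ≡ χ y → 𝟙 T (b ∙ u) ≡ χ (y ∙ u) →
                     ∣ T ∩ (⁅ b ⁆ ∪ ⁅ b ∙ u ⁆) ∣ ≡ 1
  meets-coset-once T b y Tb≡χy Tbu≡χyu =
    trans (∣∩⁅⁆∪⁅⁆∣ T (b≢bu b)) (trans (cong₂ _+_ Tb≡χy Tbu≡χyu) (χ-b+χ-bu≡1 y))

  leftCorr-off⟨u⟩ : ∀ a → notIn⟨_⟩ G u a → leftCorr G χ a ≡ 2 * n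
  leftCorr-off⟨u⟩ a a∉⟨u⟩ = begin
    leftCorr G χ a            ≡⟨ cong (leftCorr G χ) (⁻¹-involutive a) ⟨
    leftCorr G χ (a ⁻¹ ⁻¹)    ≡⟨ ∣leftTr∩∣≡leftCorr G (a ⁻¹) D ⟨
    ∣ leftTr G (a ⁻¹) D ∩ D ∣ ≡⟨ ∣aD∩D∣≡2n (a ⁻¹) (notIn⟨u⟩-⁻¹ a a∉⟨u⟩) ⟩
    2 * n                     ∎
    where open ≡-Reasoning

  rightCorr≗leftCorr-D : ∀ c → rightCorr G χ c ≡ leftCorr G χ c
  rightCorr≗leftCorr-D =
    rightCorr≗leftCorr G {φ = χ} u≢ε u-central (λ a a≢ε a≢u → leftCorr-off⟨u⟩ a (a≢ε , a≢u))

  ∣D∩Da∣≡2n : ∀ a → notIn⟨_⟩ G u a → ∣ D ∩ rightTr G D a ∣ ≡ 2 * n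
  ∣D∩Da∣≡2n a a∉⟨u⟩ = begin
    ∣ D ∩ rightTr G D a ∣   ≡⟨ ∣∩rightTr∣≡rightCorr G a D ⟩
    rightCorr G χ (a ⁻¹)    ≡⟨ rightCorr≗leftCorr-D (a ⁻¹) ⟩
    leftCorr G χ (a ⁻¹)     ≡⟨ ∣leftTr∩∣≡leftCorr G a D ⟨
    ∣ leftTr G a D ∩ D ∣    ≡⟨ ∣aD∩D∣≡2n a a∉⟨u⟩ ⟩
    2 * n                   ∎
    where open ≡-Reasoning

  ∣Da∩⁅b⁆∪⁅bu⁆∣≡1 : ∀ a b → ∣ rightTr G D a ∩ (⁅ b ⁆ ∪ ⁅ b ∙ u ⁆) ∣ ≡ 1
  ∣Da∩⁅b⁆∪⁅bu⁆∣≡1 a b = meets-coset-once (rightTr G D a) b (b ∙ a ⁻¹)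
    (𝟙-rightTr G a D b)
    (trans (𝟙-rightTr G a D (b ∙ u)) (cong χ (∙u∙≡∙∙u b (a ⁻¹))))

  isRightHadamard : IsRightHadamard n G D u
  isRightHadamard = proj₁ H , ∣D∣≡4n , ∣D∩Da∣≡2n , ∣Da∩⁅b⁆∪⁅bu⁆∣≡1

  ∣D⁻¹∣≡4n : ∣ invSet G D ∣ ≡ 4 * n
  ∣D⁻¹∣≡4n = begin
    ∣ invSet G D ∣            ≡⟨ ∣∣≡∑𝟙 (invSet G D) ⟩
    sum (𝟙 (invSet G D))      ≡⟨ sum-cong-≗ (𝟙-invSet G D) ⟩
    ∑[ x < 8 * n ] χ (x ⁻¹)   ≡⟨ ∑-⁻¹ G χ ⟩
    sum χ                     ≡⟨ ∣∣≡∑𝟙 D ⟨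
    ∣ D ∣                     ≡⟨ ∣D∣≡4n ⟩
    4 * n                     ∎
    where open ≡-Reasoning

  ∣aD⁻¹∩⁅b⁆∪⁅bu⁆∣≡1 : ∀ a b → ∣ leftTr G a (invSet G D) ∩ (⁅ b ⁆ ∪ ⁅ b ∙ u ⁆) ∣ ≡ 1
  ∣aD⁻¹∩⁅b⁆∪⁅bu⁆∣≡1 a b = meets-coset-once (leftTr G a (invSet G D)) b y
    (trans (𝟙-leftTr G a _ b) (𝟙-invSet G D _))
    (trans (𝟙-leftTr G a _ (b ∙ u)) (trans (𝟙-invSet G D _) (cong χ [a⁻¹bu]⁻¹≡yu)))
    where
    open ≡-Reasoning
    y : Fin (8 * n)
    y = (a ⁻¹ ∙ b) ⁻¹
    [a⁻¹bu]⁻¹≡yu : (a ⁻¹ ∙ (b ∙ u)) ⁻¹ ≡ y ∙ u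
    [a⁻¹bu]⁻¹≡yu = begin
      (a ⁻¹ ∙ (b ∙ u)) ⁻¹ ≡⟨ cong _⁻¹ (assoc (a ⁻¹) b u) ⟨
      (a ⁻¹ ∙ b ∙ u) ⁻¹   ≡⟨ ⁻¹-anti-homo-∙ (a ⁻¹ ∙ b) u ⟩
      u ⁻¹ ∙ y            ≡⟨ cong (_∙ y) u⁻¹≡u ⟩
      u ∙ y               ≡⟨ u-central y ⟩
      y ∙ u               ∎

  isLeftHadamard-invSet : IsLeftHadamard n G (invSet G D) u
  isLeftHadamard-invSet = proj₁ H , ∣D⁻¹∣≡4n ,
    (λ a a∉⟨u⟩ → trans (∣leftTr-invSet∩invSet∣≡rightCorr G a D)
                       (trans (rightCorr≗leftCorr-D a) (leftCorr-off⟨u⟩ a a∉⟨u⟩))) ,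
    ∣aD⁻¹∩⁅b⁆∪⁅bu⁆∣≡1

  -- In G^op the left translate aD is the right translate Da of G, and b ◇ u = u b.
  isLeftHadamard-op : IsLeftHadamard n (op G) D u
  isLeftHadamard-op = (u≢ε , u∙u≡ε , sym ∘ u-central) , ∣D∣≡4n ,
    (λ a a∉⟨u⟩ → trans (cong ∣_∣ (∩-comm (rightTr G D a) D)) (∣D∩Da∣≡2n a a∉⟨u⟩)) ,
    (λ a b → subst (λ c → ∣ rightTr G D a ∩ (⁅ b ⁆ ∪ ⁅ c ⁆) ∣ ≡ 1) (sym (u-central b))
                   (∣Da∩⁅b⁆∪⁅bu⁆∣≡1 a b))

corollary1 : (n : ℕ) (G : FinGroup (8 * n)) (D : Subset (8 * n)) (u : Fin (8 * n))
    → IsLeftHadamard n G D u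
    → IsRightHadamard n G D u
      × IsLeftHadamard n G (invSet G D) u
      × IsLeftHadamard n (op G) D u
corollary1 n G D u H = isRightHadamard , isLeftHadamard-invSet , isLeftHadamard-op
  where open LeftHadamard n G D u H
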